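{- In the DSC$(3)$ process, let $D^{(2)}(k,n)$ be the number of triangles of $\mathcal{K}(n)$ that are faces of exactly $k$ tetrahedra, and let $N_1(n),N_2(n)$ be the numbers of edges and triangles of $\mathcal{K}(n)$. Then $$D^{(2)}(0,n)=N_1(n-1)\quad\text{for } n\ge2,$$ and $$D^{(2)}(k,n)=4\big[N_2(n-k)-N_2(n-k-1)\big]\quad\text{for } n\ge3,\ 1\le k\le n-2.$$
   Context: The DSC$(3)$ process: $\mathcal{K}(0)$ consists of a single vertex. For $n\ge1$, $\mathcal{K}(n)$ is obtained from $\mathcal{K}(n-1)$ by adding, for every simplex $\sigma$ of $\mathcal{K}(n-1)$ of dimension at most $2$ (vertices, edges, triangles), a new vertex $w_\sigma$ together with the simplex $\sigma\cup\{w_\sigma\}$ and all its faces (distinct simplices receive distinct new vertices); tetrahedra receive nothing. -}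

module Defs where

open import Data.Bool using (Bool; true; false; _∧_; not)
open import Data.Nat using (ℕ; zero; suc; _+_; _≡ᵇ_; _≤ᵇ_)
open import Data.List using (List; []; _∷_; _++_; map; length; filterᵇ; deduplicateᵇ; concatMap; zip; applyUpTo)
open import Data.Product using (_×_; _,_; proj₁; proj₂)
open import Data.Bool.ListAction using (all; any)

-- A simplex is a nonempty, strictly increasing list of vertex labels (ℕ).
-- A complex is represented by its number of vertices m (labels 0 … m-1)
-- together with the duplicate-free list of all its nonempty simplices.
Simplex : Set
Simplex = List ℕ

Complex : Set
Complex = ℕ × List Simplex

eqS : Simplex → Simplex → Bool
eqS []       []       = true
eqS (x ∷ xs) (y ∷ ys) = (x ≡ᵇ y) ∧ eqS xs ys
eqS _        _        = false

subsets : List ℕ → List (List ℕ)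
subsets []       = [] ∷ []
subsets (x ∷ xs) = map (x ∷_) (subsets xs) ++ subsets xs

nonempty : List ℕ → Bool
nonempty []      = false
nonempty (_ ∷ _) = true

faces : Simplex → List Simplex
faces σ = filterᵇ nonempty (subsets σ)

hasDim : ℕ → Simplex → Bool
hasDim d σ = length σ ≡ᵇ suc d

dimAtMost2 : Simplex → Bool
dimAtMost2 σ = length σ ≤ᵇ 3

-- one step of DSC(3): every simplex σ of dimension ≤ 2 gets its own new
-- vertex w_σ (fresh labels m, m+1, …, larger than all old labels, so
-- σ ∪ {w_σ} is the sorted list σ ++ [w_σ]); we add σ ∪ {w_σ} and all its
-- faces, removing duplicates.
step : Complex → Complex
step (m , C) =
  let low   = filterᵇ dimAtMost2 C
      fresh = applyUpTo (m +_) (length low)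
      new   = concatMap (λ p → faces (proj₁ p ++ (proj₂ p ∷ []))) (zip low fresh)
  in (m + length low , deduplicateᵇ eqS (C ++ new))

K : ℕ → Complex
K zero    = 1 , ((0 ∷ []) ∷ [])
K (suc n) = step (K n)

simplices : ℕ → List Simplex
simplices n = proj₂ (K n)

count : {A : Set} → (A → Bool) → List A → ℕ
count p xs = length (filterᵇ p xs)

N : ℕ → ℕ → ℕ
N d n = count (hasDim d) (simplices n)

N₁ N₂ : ℕ → ℕ
N₁ = N 1
N₂ = N 2

elem : ℕ → List ℕ → Bool
elem x ys = any (x ≡ᵇ_) ys

isFace : Simplex → Simplex → Bool
isFace τ σ = all (λ x → elem x σ) τ

tetCount : ℕ → Simplex → ℕ
tetCount n t = count (λ σ → hasDim 3 σ ∧ isFace t σ) (simplices n)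

D2 : ℕ → ℕ → ℕ
D2 k n = count (λ t → hasDim 2 t ∧ (tetCount n t ≡ᵇ k)) (simplices n)

-- A step of DSC(3) keeps 𝒦(n) and adds, for every simplex σ of dimension ≤ 2 with
-- its fresh vertex w, the cone {τ ∪ {w} : τ ⊆ σ}. An old triangle t therefore gains
-- exactly one tetrahedron, t ∪ {w_t}, and a new triangle τ ∪ {w} (τ an edge of σ) lies
-- in exactly one tetrahedron if σ is a triangle and in none if σ is an edge. Hence
--   D(0, n+1) = N₁(n),   D(1, n+1) = D(0, n) + 3 N₂(n),   D(j+2, n+1) = D(j+1, n),
-- and likewise N₂(n+1) = N₂(n) + N₁(n) + 3 N₂(n); shifting k down to 1 gives the claim.
-- Most of the work is showing that the list program `step`, deduplication included,
-- returns exactly 𝒦(n) followed by these cones; for this we carry the invariant that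
-- all simplices are sorted, labelled below the vertex count, closed under faces and
-- pairwise distinct.

module Submission where

open import Defs
open import Level using (Level)
open import Function using (_∘_; _⇔_; mk⇔; Equivalence)
open import Data.Bool using (Bool; true; false; _∧_; not; T; T?)
open import Data.Bool.Properties using (T-∧; ∧-comm; ∧-zeroʳ; ∧-identityʳ; T-≡)
open import Data.Bool.ListAction using (all)
open import Data.Nat using (ℕ; zero; suc; _+_; _*_; _∸_; _≤_; _<_; _≡ᵇ_; _≤ᵇ_; z≤n; s≤s)
open import Data.Nat.Properties using (m≤n⇒∃[o]m+o≡n; m+n∸m≡n; ≤⇒≤ᵇ; +-comm; <⇒≢; <-irrefl; <-trans; <-≤-trans; ≤-refl; ≤-trans; n≤1+n; m≤m+n; +-suc; +-identityʳ; ≡ᵇ⇒≡; ≡⇒≡ᵇ)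
open import Data.Nat.ListAction using (sum)
open import Data.Nat.Tactic.RingSolver using (solve-∀)
open import Data.List using (List; []; _∷_; _++_; [_]; map; concatMap; zip; applyUpTo; length; filter; filterᵇ; deduplicateᵇ)
open import Data.List.Properties using (filter-accept; filter-reject; ∷-injectiveʳ; ∷ʳ-injectiveˡ; ∷ʳ-injectiveʳ; map-++; map-∘; filter-++; filter-all; filter-none; length-++; length-map)
open import Data.List.Membership.Propositional using (_∈_; _∉_)
open import Data.List.Membership.Propositional.Properties using (∈-filter⁻; ∈-++⁺ˡ; ∈-++⁺ʳ; ∈-++⁻; ∈-map⁺; ∈-map⁻)
open import Data.List.Relation.Binary.Sublist.Propositional using (_⊆_; []; _∷_; _∷ʳ_; ⊆-trans; minimum)
open import Data.List.Relation.Binary.Sublist.Propositional.Properties using (All-resp-⊆; Any-resp-⊆)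
open import Data.List.Relation.Binary.Sublist.Heterogeneous.Properties using (toPointwise)
open import Data.List.Relation.Binary.Pointwise using (Pointwise-≡⇒≡)
open import Data.List.Relation.Unary.All as All using (All; []; _∷_)
open import Data.List.Relation.Unary.Any as Any using (here; there)
open import Data.List.Relation.Unary.Any.Properties using (any⁺; any⁻)
open import Data.List.Relation.Unary.All.Properties as All using (all⁺; all⁻)
open import Data.List.Relation.Unary.AllPairs as AllPairs using (AllPairs; []; _∷_)
import Data.List.Relation.Unary.AllPairs.Properties as AllPairs
open import Data.List.Relation.Unary.Unique.Propositional using (Unique)
import Data.List.Relation.Unary.Unique.Propositional.Properties as Unique
open import Data.Product using (_×_; _,_; proj₁; proj₂; ∃-syntax)
open import Data.Sum using (_⊎_; inj₁; inj₂)
open import Data.Empty using (⊥-elim)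
open import Relation.Nullary using (¬_; does)
open import Relation.Unary using (Pred; Decidable)
open import Relation.Binary.PropositionalEquality using (_≡_; _≢_; refl; sym; trans; cong; cong₂; subst; module ≡-Reasoning)

private variable
  ℓ : Level
  A B : Set

module _ (p : A → Bool) where

  filterᵇ-map : (f : B → A) (xs : List B) → filterᵇ p (map f xs) ≡ map f (filterᵇ (p ∘ f) xs)
  filterᵇ-map f [] = refl
  filterᵇ-map f (x ∷ xs) with p (f x)
  ... | true  = cong (f x ∷_) (filterᵇ-map f xs)
  ... | false = filterᵇ-map f xs

  filterᵇ-filterᵇ : (q : A → Bool) (xs : List A) → filterᵇ p (filterᵇ q xs) ≡ filterᵇ (λ x → p x ∧ q x) xs
  filterᵇ-filterᵇ q [] = refl
  filterᵇ-filterᵇ q (x ∷ xs) with q x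
  ... | false rewrite ∧-zeroʳ (p x) = filterᵇ-filterᵇ q xs
  ... | true rewrite ∧-identityʳ (p x) with p x
  ...   | true  = cong (x ∷_) (filterᵇ-filterᵇ q xs)
  ...   | false = filterᵇ-filterᵇ q xs

  filterᵇ-cong : (q : A → Bool) (xs : List A) → (∀ {x} → x ∈ xs → p x ≡ q x) → filterᵇ p xs ≡ filterᵇ q xs
  filterᵇ-cong q [] eq = refl
  filterᵇ-cong q (x ∷ xs) eq with p x | q x | eq (here refl)
  ... | true  | true  | refl = cong (x ∷_) (filterᵇ-cong q xs (eq ∘ there))
  ... | false | false | refl = filterᵇ-cong q xs (eq ∘ there)

filterᵇ-comm : (p q : A → Bool) (xs : List A) → filterᵇ p (filterᵇ q xs) ≡ filterᵇ q (filterᵇ p xs)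
filterᵇ-comm p q xs = begin
  filterᵇ p (filterᵇ q xs)           ≡⟨ filterᵇ-filterᵇ p q xs ⟩
  filterᵇ (λ x → p x ∧ q x) xs       ≡⟨ filterᵇ-cong _ _ xs (λ {x} _ → ∧-comm (p x) (q x)) ⟩
  filterᵇ (λ x → q x ∧ p x) xs       ≡⟨ filterᵇ-filterᵇ q p xs ⟨
  filterᵇ q (filterᵇ p xs)           ∎
  where open ≡-Reasoning

filterᵇ-absorb : (p q : A → Bool) (xs : List A) → (∀ {x} → T (p x) → T (q x)) →
                 filterᵇ p (filterᵇ q xs) ≡ filterᵇ p xs
filterᵇ-absorb p q xs p⇒q = trans (filterᵇ-filterᵇ p q xs) (filterᵇ-cong _ p xs (λ {x} _ → p∧q≡p x))
  where
  p∧q≡p : ∀ x → (p x ∧ q x) ≡ p x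
  p∧q≡p x with p x | p⇒q {x}
  ... | true  | px⇒qx = Equivalence.to T-≡ (px⇒qx _)
  ... | false | _     = refl

module _ (p : A → Bool) where

  count-++ : (xs ys : List A) → count p (xs ++ ys) ≡ count p xs + count p ys
  count-++ xs ys = trans (cong length (filter-++ _ xs ys)) (length-++ (filterᵇ p xs))

  count-map : (f : B → A) (xs : List B) → count p (map f xs) ≡ count (p ∘ f) xs
  count-map f xs = trans (cong length (filterᵇ-map p f xs)) (length-map f (filterᵇ (p ∘ f) xs))

  count-cong : (q : A → Bool) (xs : List A) → (∀ {x} → x ∈ xs → p x ≡ q x) → count p xs ≡ count q xs
  count-cong q xs eq = cong length (filterᵇ-cong p q xs eq)

  count-none : (xs : List A) → (∀ {x} → x ∈ xs → p x ≡ false) → count p xs ≡ 0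
  count-none xs none = cong length (filter-none (T? ∘ p) (All.tabulate (λ x∈xs → subst T (none x∈xs))))

  count-filterᵇ : (q : A → Bool) (xs : List A) → (∀ {x} → T (p x) → T (q x)) →
                  count p (filterᵇ q xs) ≡ count p xs
  count-filterᵇ q xs p⇒q = cong length (filterᵇ-absorb p q xs p⇒q)

sum-count-[] : (p : A → Bool) (xs : List A) → sum (map (λ x → count p [ x ]) xs) ≡ count p xs
sum-count-[] p [] = refl
sum-count-[] p (x ∷ xs) = trans (cong (count p [ x ] +_) (sum-count-[] p xs)) (sym (count-++ p [ x ] xs))

T-ext : {a b : Bool} → (T a → T b) → (T b → T a) → a ≡ b
T-ext {false} {false} _ _ = refl
T-ext {false} {true}  _ b⇒a = ⊥-elim (b⇒a _)
T-ext {true}  {false} a⇒b _ = ⊥-elim (a⇒b _)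
T-ext {true}  {true}  _ _ = refl

filter-does : {P Q : Pred A ℓ} (P? : Decidable P) (Q? : Decidable Q) →
              (∀ x → does (P? x) ≡ does (Q? x)) → (xs : List A) → filter P? xs ≡ filter Q? xs
filter-does P? Q? eq [] = refl
filter-does P? Q? eq (x ∷ xs) with does (P? x) | does (Q? x) | eq x
... | true  | true  | refl = cong (x ∷_) (filter-does P? Q? eq xs)
... | false | false | refl = filter-does P? Q? eq xs

module _ (r : A → A → Bool) where

  freshFrom : List A → A → Bool
  freshFrom xs y = all (λ x → not (r x y)) xs

  -- deduplicateᵇ filters with ¬? ∘ T?, not T? ∘ not, so it unfolds to filterᵇ only up to ≡.
  deduplicateᵇ-∷ : (x : A) (xs : List A) →
                   deduplicateᵇ r (x ∷ xs) ≡ x ∷ filterᵇ (not ∘ r x) (deduplicateᵇ r xs)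
  deduplicateᵇ-∷ x xs = cong (x ∷_) (filter-does _ _ (λ _ → refl) (deduplicateᵇ r xs))

  deduplicateᵇ-++ : (xs ys : List A) →
    deduplicateᵇ r (xs ++ ys) ≡ deduplicateᵇ r xs ++ filterᵇ (freshFrom xs) (deduplicateᵇ r ys)
  deduplicateᵇ-++ [] ys = sym (filter-all _ (All.universal _ (deduplicateᵇ r ys)))
  deduplicateᵇ-++ (x ∷ xs) ys = begin
    deduplicateᵇ r (x ∷ xs ++ ys)
      ≡⟨ deduplicateᵇ-∷ x (xs ++ ys) ⟩
    x ∷ filterᵇ (not ∘ r x) (deduplicateᵇ r (xs ++ ys))
      ≡⟨ cong (λ zs → x ∷ filterᵇ (not ∘ r x) zs) (deduplicateᵇ-++ xs ys) ⟩
    x ∷ filterᵇ (not ∘ r x) (deduplicateᵇ r xs ++ filterᵇ (freshFrom xs) (deduplicateᵇ r ys))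
      ≡⟨ cong (x ∷_) (filter-++ _ (deduplicateᵇ r xs) _) ⟩
    x ∷ filterᵇ (not ∘ r x) (deduplicateᵇ r xs)
      ++ filterᵇ (not ∘ r x) (filterᵇ (freshFrom xs) (deduplicateᵇ r ys))
      ≡⟨ cong₂ _++_ (deduplicateᵇ-∷ x xs)
                    (sym (filterᵇ-filterᵇ (not ∘ r x) (freshFrom xs) (deduplicateᵇ r ys))) ⟨
    deduplicateᵇ r (x ∷ xs) ++ filterᵇ (freshFrom (x ∷ xs)) (deduplicateᵇ r ys)
      ∎
    where open ≡-Reasoning

  freshFrom-∈ : (r-refl : ∀ x → T (r x x)) {y : A} {xs : List A} → y ∈ xs → ¬ T (freshFrom xs y)
  freshFrom-∈ r-refl {y} {xs} y∈xs fresh with r y y | r-refl y | All.lookup (all⁺ _ xs fresh) y∈xs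
  ... | true | _ | ()

  module _ (r⇒≡ : ∀ {x y} → T (r x y) → x ≡ y) where

    r-false : ∀ {x y} → x ≢ y → r x y ≡ false
    r-false {x} {y} x≢y with r x y in eq
    ... | true  = ⊥-elim (x≢y (r⇒≡ (subst T (sym eq) _)))
    ... | false = refl

    freshFrom-∉ : {y : A} (xs : List A) → y ∉ xs → T (freshFrom xs y)
    freshFrom-∉ {y} xs y∉xs =
      all⁻ _ (All.tabulate (λ {x} x∈xs → not-false (r-false {x} {y} (λ { refl → y∉xs x∈xs }))))
      where
      not-false : ∀ {b} → b ≡ false → T (not b)
      not-false refl = _

    count-unique : (r-refl : ∀ x → T (r x x)) {x : A} {xs : List A} → Unique xs → x ∈ xs → count (r x) xs ≡ 1
    count-unique r-refl {x} (x∉xs ∷ _) (here refl) with r x x | r-refl x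
    ... | true | _ = cong suc (count-none (r x) _ (λ x′∈ → r-false (All.lookup x∉xs x′∈)))
    count-unique r-refl {x} {y ∷ _} (x≢ys ∷ uniq) (there x∈)
      rewrite r-false {x} {y} (λ { refl → All.lookup x≢ys x∈ refl }) = count-unique r-refl uniq x∈

    filterᵇ-deduplicateᵇ : (p : A → Bool) (xs : List A) →
      filterᵇ p (deduplicateᵇ r xs) ≡ deduplicateᵇ r (filterᵇ p xs)
    filterᵇ-deduplicateᵇ p [] = refl
    filterᵇ-deduplicateᵇ p (x ∷ xs) =
      trans (cong (filterᵇ p) (deduplicateᵇ-∷ x xs)) filter-head
      where
      open ≡-Reasoning
      filter-head : filterᵇ p (x ∷ filterᵇ (not ∘ r x) (deduplicateᵇ r xs))
                    ≡ deduplicateᵇ r (filterᵇ p (x ∷ xs))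
      filter-head with p x in px
      ... | true = begin
        x ∷ filterᵇ p (filterᵇ (not ∘ r x) (deduplicateᵇ r xs))
          ≡⟨ cong (x ∷_) (filterᵇ-comm p _ (deduplicateᵇ r xs)) ⟩
        x ∷ filterᵇ (not ∘ r x) (filterᵇ p (deduplicateᵇ r xs))
          ≡⟨ cong (λ zs → x ∷ filterᵇ (not ∘ r x) zs) (filterᵇ-deduplicateᵇ p xs) ⟩
        x ∷ filterᵇ (not ∘ r x) (deduplicateᵇ r (filterᵇ p xs))
          ≡⟨ deduplicateᵇ-∷ x (filterᵇ p xs) ⟨
        deduplicateᵇ r (x ∷ filterᵇ p xs)
          ∎
      ... | false = trans (filterᵇ-absorb p _ (deduplicateᵇ r xs) p⇒≢x) (filterᵇ-deduplicateᵇ p xs)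
        where
        p⇒≢x : ∀ {y} → T (p y) → T (not (r x y))
        p⇒≢x {y} py rewrite r-false {x} {y} (λ { refl → subst T px py }) = _

    deduplicateᵇ-unique : (xs : List A) → Unique xs → deduplicateᵇ r xs ≡ xs
    deduplicateᵇ-unique [] _ = refl
    deduplicateᵇ-unique (x ∷ xs) (x∉xs ∷ uniq) = begin
      deduplicateᵇ r (x ∷ xs)
        ≡⟨ deduplicateᵇ-∷ x xs ⟩
      x ∷ filterᵇ (not ∘ r x) (deduplicateᵇ r xs)
        ≡⟨ cong (λ zs → x ∷ filterᵇ (not ∘ r x) zs) (deduplicateᵇ-unique xs uniq) ⟩
      x ∷ filterᵇ (not ∘ r x) xs
        ≡⟨ cong (x ∷_) (filter-all _ (All.map distinct x∉xs)) ⟩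
      x ∷ xs
        ∎
      where
      open ≡-Reasoning
      distinct : ∀ {y} → x ≢ y → T (not (r x y))
      distinct x≢y rewrite r-false x≢y = _

∈-subsets⁻ : {τ σ : Simplex} → τ ∈ subsets σ → τ ⊆ σ
∈-subsets⁻ {σ = []} (here refl) = []
∈-subsets⁻ {σ = x ∷ σ} τ∈ with ∈-++⁻ (map (x ∷_) (subsets σ)) τ∈
... | inj₂ τ∈′ = x ∷ʳ ∈-subsets⁻ τ∈′
... | inj₁ τ∈′ with ∈-map⁻ (x ∷_) τ∈′
...   | τ′ , τ′∈ , refl = refl ∷ ∈-subsets⁻ τ′∈

∈-subsets⁺ : {τ σ : Simplex} → τ ⊆ σ → τ ∈ subsets σ
∈-subsets⁺ [] = here refl
∈-subsets⁺ {σ = x ∷ σ} (_ ∷ʳ τ⊆σ) = ∈-++⁺ʳ (map (x ∷_) (subsets σ)) (∈-subsets⁺ τ⊆σ)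
∈-subsets⁺ (refl ∷ τ⊆σ) = ∈-++⁺ˡ (∈-map⁺ _ (∈-subsets⁺ τ⊆σ))

∷ʳ-⊆⁺ : {τ σ : List A} (w : A) → τ ⊆ σ → τ ++ [ w ] ⊆ σ ++ [ w ]
∷ʳ-⊆⁺ w [] = refl ∷ []
∷ʳ-⊆⁺ w (y ∷ʳ τ⊆σ) = y ∷ʳ ∷ʳ-⊆⁺ w τ⊆σ
∷ʳ-⊆⁺ w (refl ∷ τ⊆σ) = refl ∷ ∷ʳ-⊆⁺ w τ⊆σ

∷ʳ-⊆⁻ : {t : List A} (τ : List A) (w : A) → t ⊆ τ ++ [ w ] →
        t ⊆ τ ⊎ ∃[ t′ ] t′ ⊆ τ × t ≡ t′ ++ [ w ]
∷ʳ-⊆⁻ [] w (_ ∷ʳ []) = inj₁ []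
∷ʳ-⊆⁻ [] w (refl ∷ []) = inj₂ ([] , [] , refl)
∷ʳ-⊆⁻ (y ∷ τ) w (_ ∷ʳ t⊆) with ∷ʳ-⊆⁻ τ w t⊆
... | inj₁ t⊆τ = inj₁ (y ∷ʳ t⊆τ)
... | inj₂ (t′ , t′⊆τ , eq) = inj₂ (t′ , y ∷ʳ t′⊆τ , eq)
∷ʳ-⊆⁻ (y ∷ τ) w (refl ∷ t⊆) with ∷ʳ-⊆⁻ τ w t⊆
... | inj₁ t⊆τ = inj₁ (refl ∷ t⊆τ)
... | inj₂ (t′ , t′⊆τ , refl) = inj₂ (y ∷ t′ , refl ∷ t′⊆τ , refl)

AllPairs-resp-⊆ : {R : A → A → Set} {xs ys : List A} → xs ⊆ ys → AllPairs R ys → AllPairs R xs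
AllPairs-resp-⊆ [] [] = []
AllPairs-resp-⊆ (_ ∷ʳ xs⊆ys) (_ ∷ rys) = AllPairs-resp-⊆ xs⊆ys rys
AllPairs-resp-⊆ (refl ∷ xs⊆ys) (rx ∷ rys) = All-resp-⊆ xs⊆ys rx ∷ AllPairs-resp-⊆ xs⊆ys rys

Unique-subsets : (σ : Simplex) → Unique σ → Unique (subsets σ)
Unique-subsets [] [] = [] ∷ []
Unique-subsets (x ∷ σ) (x∉σ ∷ uniq) =
  Unique.++⁺ (Unique.map⁺ ∷-injectiveʳ (Unique-subsets σ uniq)) (Unique-subsets σ uniq) disjoint
  where
  disjoint : ∀ {τ} → ¬ (τ ∈ map (x ∷_) (subsets σ) × τ ∈ subsets σ)
  disjoint (τ∈ , τ∈′) with ∈-map⁻ (x ∷_) τ∈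
  ... | _ , _ , refl = All.lookup (All-resp-⊆ (∈-subsets⁻ τ∈′) x∉σ) (here refl) refl

filterᵇ-subsets-++[] : (p : Simplex → Bool) (σ : Simplex) (w : ℕ) →
  (∀ {τ} → τ ⊆ σ → T (p (τ ++ [ w ]))) → (∀ {τ} → τ ⊆ σ → ¬ T (p τ)) →
  filterᵇ p (subsets (σ ++ [ w ])) ≡ map (_++ [ w ]) (subsets σ)
filterᵇ-subsets-++[] p [] w with-w without-w =
  trans (filter-accept (T? ∘ p) (with-w [])) (cong ([ w ] ∷_) (filter-reject (T? ∘ p) {xs = []} (without-w [])))
filterᵇ-subsets-++[] p (x ∷ σ) w with-w without-w = begin
  filterᵇ p (map (x ∷_) S ++ S)
    ≡⟨ filter-++ _ (map (x ∷_) S) S ⟩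
  filterᵇ p (map (x ∷_) S) ++ filterᵇ p S
    ≡⟨ cong (_++ filterᵇ p S) (filterᵇ-map p (x ∷_) S) ⟩
  map (x ∷_) (filterᵇ (p ∘ (x ∷_)) S) ++ filterᵇ p S
    ≡⟨ cong₂ (λ us vs → map (x ∷_) us ++ vs)
         (filterᵇ-subsets-++[] (p ∘ (x ∷_)) σ w (with-w ∘ (refl ∷_)) (without-w ∘ (refl ∷_)))
         (filterᵇ-subsets-++[] p σ w (with-w ∘ (x ∷ʳ_)) (without-w ∘ (x ∷ʳ_))) ⟩
  map (x ∷_) (map (_++ [ w ]) (subsets σ)) ++ map (_++ [ w ]) (subsets σ)
    -- x ∷_ and _++ [ w ] commute definitionally
    ≡⟨ cong (_++ map (_++ [ w ]) (subsets σ)) (trans (sym (map-∘ (subsets σ))) (map-∘ (subsets σ))) ⟩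
  map (_++ [ w ]) (map (x ∷_) (subsets σ)) ++ map (_++ [ w ]) (subsets σ)
    ≡⟨ map-++ (_++ [ w ]) (map (x ∷_) (subsets σ)) (subsets σ) ⟨
  map (_++ [ w ]) (subsets (x ∷ σ))
    ∎
  where
  open ≡-Reasoning
  S : List Simplex
  S = subsets (σ ++ [ w ])

Sorted : List ℕ → Set
Sorted = AllPairs _<_

∈-tail : {y z : ℕ} {ys : List ℕ} → y < z → z ∈ y ∷ ys → z ∈ ys
∈-tail y<z (here refl) = ⊥-elim (<-irrefl refl y<z)
∈-tail y<z (there z∈ys) = z∈ys

Sorted-All∈⇒⊆ : {xs ys : List ℕ} → Sorted xs → Sorted ys → All (_∈ ys) xs → xs ⊆ ys
Sorted-All∈⇒⊆ {[]} {ys} _ _ _ = minimum ys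
Sorted-All∈⇒⊆ {x ∷ xs} {y ∷ ys} (x<xs ∷ sxs) (y<ys ∷ sys) (here refl ∷ xs∈) =
  refl ∷ Sorted-All∈⇒⊆ sxs sys (All.zipWith (λ (x<z , z∈) → ∈-tail x<z z∈) (x<xs , xs∈))
Sorted-All∈⇒⊆ {x ∷ xs} {y ∷ ys} sxs@(x<xs ∷ _) (y<ys ∷ sys) (there x∈ys ∷ xs∈) =
  y ∷ʳ Sorted-All∈⇒⊆ sxs sys
         (∈-tail y<x (there x∈ys) ∷ All.zipWith (λ (x<z , z∈) → ∈-tail (<-trans y<x x<z) z∈) (x<xs , xs∈))
  where
  y<x : y < x
  y<x = All.lookup y<ys x∈ys

Sorted-All∈⇒≡ : {t σ : List ℕ} → length t ≡ length σ → Sorted t → Sorted σ → All (_∈ σ) t → t ≡ σ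
Sorted-All∈⇒≡ eq st sσ t∈σ = Pointwise-≡⇒≡ (toPointwise eq (Sorted-All∈⇒⊆ st sσ t∈σ))

eqS⇒≡ : {s t : Simplex} → T (eqS s t) → s ≡ t
eqS⇒≡ {[]} {[]} _ = refl
eqS⇒≡ {x ∷ s} {y ∷ t} eq with x ≡ᵇ y in x≡ᵇy
... | true = cong₂ _∷_ (≡ᵇ⇒≡ x y (subst T (sym x≡ᵇy) _)) (eqS⇒≡ eq)

eqS-refl : (s : Simplex) → T (eqS s s)
eqS-refl [] = _
eqS-refl (x ∷ s) rewrite Equivalence.to T-≡ (≡⇒≡ᵇ x x refl) = eqS-refl s

elem⇔∈ : (x : ℕ) (ys : List ℕ) → T (elem x ys) ⇔ x ∈ ys
elem⇔∈ x ys = mk⇔ (Any.map (≡ᵇ⇒≡ x _) ∘ any⁻ _ ys) (any⁺ _ ∘ Any.map (≡⇒≡ᵇ x _))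

isFace⇔All∈ : (t σ : Simplex) → T (isFace t σ) ⇔ All (_∈ σ) t
isFace⇔All∈ t σ =
  mk⇔ (All.map (Equivalence.to (elem⇔∈ _ σ)) ∘ all⁺ _ t) (all⁻ _ ∘ All.map (Equivalence.from (elem⇔∈ _ σ)))

nonempty-++[] : (τ : Simplex) (w : ℕ) → T (nonempty (τ ++ [ w ]))
nonempty-++[] []      w = _
nonempty-++[] (_ ∷ _) w = _

hasDim⇒dimAtMost2 : ∀ {d} → d ≤ 2 → (σ : Simplex) → T (hasDim d σ) → T (dimAtMost2 σ)
hasDim⇒dimAtMost2 {d} d≤2 σ σ-dim =
  subst (λ k → T (k ≤ᵇ 3)) (sym (≡ᵇ⇒≡ (length σ) (suc d) σ-dim)) (≤⇒≤ᵇ (s≤s d≤2))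

hasDim-++[] : (d : ℕ) (τ : Simplex) (w : ℕ) → hasDim (suc d) (τ ++ [ w ]) ≡ hasDim d τ
hasDim-++[] d τ w = cong (_≡ᵇ suc (suc d)) (trans (length-++ τ) (+-comm (length τ) 1))

isFace-++[] : (t τ : Simplex) (w : ℕ) → w ∉ t → isFace t (τ ++ [ w ]) ≡ isFace t τ
isFace-++[] t τ w w∉t = T-ext
  (λ t⊆τw → from (isFace⇔All∈ t τ)
              (All.tabulate (λ x∈t → drop-w x∈t (All.lookup (to (isFace⇔All∈ t (τ ++ [ w ])) t⊆τw) x∈t))))
  (λ t⊆τ → from (isFace⇔All∈ t (τ ++ [ w ])) (All.map ∈-++⁺ˡ (to (isFace⇔All∈ t τ) t⊆τ)))
  where
  open Equivalence using (to; from)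
  drop-w : ∀ {x} → x ∈ t → x ∈ τ ++ [ w ] → x ∈ τ
  drop-w x∈t x∈ with ∈-++⁻ τ x∈
  ... | inj₁ x∈τ = x∈τ
  ... | inj₂ (here refl) = ⊥-elim (w∉t x∈t)

tetOver : Simplex → Simplex → Bool
tetOver t σ = hasDim 3 σ ∧ isFace t σ

tetOver-∉ : {x : ℕ} {t s : Simplex} → x ∈ t → x ∉ s → tetOver t s ≡ false
tetOver-∉ {t = t} {s} x∈t x∉s = T-ext
  (λ h → x∉s (All.lookup (Equivalence.to (isFace⇔All∈ t s) (proj₂ (Equivalence.to (T-∧ {hasDim 3 s}) h))) x∈t))
  (λ ())

triangle-face-≡ : {t σ : Simplex} → Sorted t → Sorted σ → T (hasDim 2 t) → (hasDim 2 σ ∧ isFace t σ) ≡ eqS t σ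
triangle-face-≡ {t} {σ} st sσ t-tri = T-ext face⇒≡ ≡⇒face
  where
  face⇒≡ : T (hasDim 2 σ ∧ isFace t σ) → T (eqS t σ)
  face⇒≡ h with Equivalence.to T-∧ h
  ... | σ-tri , t⊆σ = subst (T ∘ eqS t) t≡σ (eqS-refl t)
    where
    t≡σ : t ≡ σ
    t≡σ = Sorted-All∈⇒≡ (trans (≡ᵇ⇒≡ _ 3 t-tri) (sym (≡ᵇ⇒≡ _ 3 σ-tri))) st sσ
                        (Equivalence.to (isFace⇔All∈ t σ) t⊆σ)
  ≡⇒face : T (eqS t σ) → T (hasDim 2 σ ∧ isFace t σ)
  ≡⇒face eq with eqS⇒≡ {t} {σ} eq
  ... | refl = Equivalence.from T-∧ (t-tri , Equivalence.from (isFace⇔All∈ t t) (All.tabulate (λ x∈t → x∈t)))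

cone : Simplex → ℕ → List Simplex
cone σ w = map (_++ [ w ]) (subsets σ)

-- The simplices that step adds when the simplices l of dimension ≤ 2 receive the
-- fresh vertices k, k + 1, … in order.
cones : ℕ → List Simplex → List Simplex
cones k []      = []
cones k (σ ∷ l) = cone σ k ++ cones (suc k) l

data ConeOf : ℕ → List Simplex → Simplex → ℕ → Set where
  here  : ∀ {k σ l} → ConeOf k (σ ∷ l) σ k
  there : ∀ {k σ σ′ l w} → ConeOf (suc k) l σ w → ConeOf k (σ′ ∷ l) σ w

ConeOf⇒∈ : ∀ {k l σ w} → ConeOf k l σ w → σ ∈ l
ConeOf⇒∈ here      = here refl
ConeOf⇒∈ (there c) = there (ConeOf⇒∈ c)

ConeOf⇒≤ : ∀ {k l σ w} → ConeOf k l σ w → k ≤ w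
ConeOf⇒≤ here      = ≤-refl
ConeOf⇒≤ (there c) = ≤-trans (n≤1+n _) (ConeOf⇒≤ c)

ConeOf⇒< : ∀ {k l σ w} → ConeOf k l σ w → w < k + length l
ConeOf⇒< {k} {_ ∷ l} here = subst (k <_) (sym (+-suc k (length l))) (s≤s (m≤m+n k (length l)))
ConeOf⇒< {k} {_ ∷ l} {w = w} (there c) = subst (w <_) (sym (+-suc k (length l))) (ConeOf⇒< c)

∈-cones⁻ : ∀ k l {u} → u ∈ cones k l → ∃[ σ ] ∃[ w ] ∃[ τ ] ConeOf k l σ w × τ ⊆ σ × u ≡ τ ++ [ w ]
∈-cones⁻ k (σ ∷ l) u∈ with ∈-++⁻ (cone σ k) u∈
... | inj₁ u∈cone with ∈-map⁻ (_++ [ k ]) u∈cone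
...   | τ , τ∈ , eq = σ , k , τ , here , ∈-subsets⁻ τ∈ , eq
∈-cones⁻ k (σ ∷ l) u∈ | inj₂ u∈cones with ∈-cones⁻ (suc k) l u∈cones
...   | σ′ , w , τ , c , τ⊆σ′ , eq = σ′ , w , τ , there c , τ⊆σ′ , eq

∈-cones⁺ : ∀ {k l σ w τ} → ConeOf k l σ w → τ ⊆ σ → τ ++ [ w ] ∈ cones k l
∈-cones⁺ {k} here τ⊆σ = ∈-++⁺ˡ (∈-map⁺ (_++ [ k ]) (∈-subsets⁺ τ⊆σ))
∈-cones⁺ {k} {σ′ ∷ _} (there c) τ⊆σ = ∈-++⁺ʳ (cone σ′ k) (∈-cones⁺ c τ⊆σ)

Unique-cones : ∀ k l → All Unique l → Unique (cones k l)
Unique-cones k [] [] = []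
Unique-cones k (σ ∷ l) (uσ ∷ ul) =
  Unique.++⁺ (Unique.map⁺ (λ {τ} {τ′} → ∷ʳ-injectiveˡ τ τ′) (Unique-subsets σ uσ))
             (Unique-cones (suc k) l ul) disjoint
  where
  disjoint : ∀ {u} → ¬ (u ∈ cone σ k × u ∈ cones (suc k) l)
  disjoint (u∈cone , u∈cones) with ∈-map⁻ (_++ [ k ]) u∈cone | ∈-cones⁻ (suc k) l u∈cones
  ... | τ , _ , refl | _ , w , τ′ , c , _ , eq = <-irrefl (∷ʳ-injectiveʳ τ τ′ eq) (ConeOf⇒≤ c)

count-cones : (p : Simplex → Bool) (f : Simplex → ℕ) (k : ℕ) (l : List Simplex) →
  (∀ {σ w} → ConeOf k l σ w → count p (cone σ w) ≡ f σ) → count p (cones k l) ≡ sum (map f l)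
count-cones p f k [] _ = refl
count-cones p f k (σ ∷ l) per-cone =
  trans (count-++ p (cone σ k) (cones (suc k) l))
        (cong₂ _+_ (per-cone here) (count-cones p f (suc k) l (per-cone ∘ there)))

count-cones-none : (p : Simplex → Bool) (k : ℕ) (l : List Simplex) →
  (∀ {σ w} → ConeOf k l σ w → count p (cone σ w) ≡ 0) → count p (cones k l) ≡ 0
count-cones-none p k [] _ = refl
count-cones-none p k (σ ∷ l) none =
  trans (count-++ p (cone σ k) (cones (suc k) l)) (cong₂ _+_ (none here) (count-cones-none p (suc k) l (none ∘ there)))

count-cones-apex : (p : Simplex → Bool) {k : ℕ} {l : List Simplex} {σ : Simplex} {w : ℕ} → ConeOf k l σ w →
  (∀ {σ′ w′} → ConeOf k l σ′ w′ → w′ ≢ w → count p (cone σ′ w′) ≡ 0) →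
  count p (cones k l) ≡ count p (cone σ w)
count-cones-apex p {k} {σ ∷ l} here others =
  trans (count-++ p (cone σ k) (cones (suc k) l))
    (trans (cong (count p (cone σ k) +_)
                 (count-cones-none p (suc k) l (λ c → others (there c) (k<w⇒w≢k (ConeOf⇒≤ c)))))
           (+-identityʳ _))
  where
  k<w⇒w≢k : ∀ {w} → suc k ≤ w → w ≢ k
  k<w⇒w≢k k<w refl = <-irrefl refl k<w
count-cones-apex p {k} {σ′ ∷ l} (there c) others =
  trans (count-++ p (cone σ′ k) (cones (suc k) l))
        (cong₂ _+_ (others here (λ { refl → <-irrefl refl (ConeOf⇒≤ c) })) (count-cones-apex p c (others ∘ there)))

-- One step of the process

low : List Simplex → List Simplex
low = filterᵇ dimAtMost2

record WellFormed (m : ℕ) (C : List Simplex) : Set where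
  field
    bounded : ∀ {σ} → σ ∈ C → All (_< m) σ
    sorted  : ∀ {σ} → σ ∈ C → Sorted σ
    closed  : ∀ {σ τ} → σ ∈ C → τ ⊆ σ → T (nonempty τ) → τ ∈ C
    unique  : Unique C

module _ {m : ℕ} {C : List Simplex} (wf : WellFormed m C) where
  open WellFormed wf

  fresh-∉ : ∀ {w} (τ : Simplex) → m ≤ w → τ ++ [ w ] ∉ C
  fresh-∉ τ m≤w τw∈C = <-irrefl refl (<-≤-trans (All.lookup (bounded τw∈C) (∈-++⁺ʳ τ (here refl))) m≤w)

  new-faces-of : ∀ {σ k} → σ ∈ C → m ≤ k → filterᵇ (freshFrom eqS C) (faces (σ ++ [ k ])) ≡ cone σ k
  new-faces-of {σ} {k} σ∈C m≤k =
    trans (filterᵇ-filterᵇ _ nonempty (subsets (σ ++ [ k ]))) (filterᵇ-subsets-++[] _ σ k new old)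
    where
    new : ∀ {τ} → τ ⊆ σ → T (freshFrom eqS C (τ ++ [ k ]) ∧ nonempty (τ ++ [ k ]))
    new {τ} _ = Equivalence.from T-∧ (freshFrom-∉ eqS eqS⇒≡ C (fresh-∉ τ m≤k) , nonempty-++[] τ k)
    old : ∀ {τ} → τ ⊆ σ → ¬ T (freshFrom eqS C τ ∧ nonempty τ)
    old τ⊆σ fresh∧nonempty with Equivalence.to T-∧ fresh∧nonempty
    ... | fresh , τ≢[] = freshFrom-∈ eqS eqS-refl (closed σ∈C τ⊆σ τ≢[]) fresh

  new-faces : (f : ℕ → ℕ) (k : ℕ) (l : List Simplex) → m ≤ k → (∀ i → f i ≡ k + i) → All (_∈ C) l →
    filterᵇ (freshFrom eqS C) (concatMap (λ p → faces (proj₁ p ++ [ proj₂ p ])) (zip l (applyUpTo f (length l))))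
      ≡ cones k l
  new-faces f k [] _ _ _ = refl
  new-faces f k (σ ∷ l) m≤k f≡ (σ∈C ∷ l⊆C) =
    trans (filter-++ _ (faces (σ ++ [ f 0 ])) _)
      (cong₂ _++_ (trans (cong (λ w → filterᵇ (freshFrom eqS C) (faces (σ ++ [ w ]))) (trans (f≡ 0) (+-identityʳ k)))
                         (new-faces-of σ∈C m≤k))
                  (new-faces (f ∘ suc) (suc k) l (≤-trans m≤k (n≤1+n k))
                             (λ i → trans (f≡ (suc i)) (+-suc k i)) l⊆C))

  low⊆ : All (_∈ C) (low C)
  low⊆ = All.tabulate (proj₁ ∘ ∈-filter⁻ (T? ∘ dimAtMost2))

  unique-cones : Unique (cones m (low C))
  unique-cones = Unique-cones m (low C) (All.map (AllPairs.map <⇒≢ ∘ sorted) low⊆)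

  step-≡ : step (m , C) ≡ (m + length (low C) , C ++ cones m (low C))
  step-≡ = cong (m + length (low C) ,_) (begin
    deduplicateᵇ eqS (C ++ new)
      ≡⟨ deduplicateᵇ-++ eqS C new ⟩
    deduplicateᵇ eqS C ++ filterᵇ (freshFrom eqS C) (deduplicateᵇ eqS new)
      ≡⟨ cong₂ _++_ (deduplicateᵇ-unique eqS eqS⇒≡ C unique) (filterᵇ-deduplicateᵇ eqS eqS⇒≡ _ new) ⟩
    C ++ deduplicateᵇ eqS (filterᵇ (freshFrom eqS C) new)
      ≡⟨ cong (λ zs → C ++ deduplicateᵇ eqS zs) (new-faces (m +_) m (low C) ≤-refl (λ _ → refl) low⊆) ⟩
    C ++ deduplicateᵇ eqS (cones m (low C))
      ≡⟨ cong (C ++_) (deduplicateᵇ-unique eqS eqS⇒≡ _ unique-cones) ⟩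
    C ++ cones m (low C)
      ∎)
    where
    open ≡-Reasoning
    new : List Simplex
    new = concatMap (λ p → faces (proj₁ p ++ [ proj₂ p ])) (zip (low C) (applyUpTo (m +_) (length (low C))))

  WellFormed-step : WellFormed (m + length (low C)) (C ++ cones m (low C))
  WellFormed-step = record
    { bounded = bounded′ ; sorted = sorted′ ; closed = closed′
    ; unique = Unique.++⁺ unique unique-cones old∉new }
    where
    M : ℕ
    M = m + length (low C)
    weaken : ∀ {σ} → All (_< m) σ → All (_< M) σ
    weaken = All.map (λ x<m → <-≤-trans x<m (m≤m+n m (length (low C))))

    bounded′ : ∀ {s} → s ∈ C ++ cones m (low C) → All (_< M) s
    bounded′ s∈ with ∈-++⁻ C s∈
    ... | inj₁ s∈C = weaken (bounded s∈C)
    ... | inj₂ s∈new with ∈-cones⁻ m (low C) s∈new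
    ...   | σ , w , τ , c , τ⊆σ , refl =
      All.++⁺ (All-resp-⊆ τ⊆σ (weaken (bounded (All.lookup low⊆ (ConeOf⇒∈ c))))) (ConeOf⇒< c ∷ [])

    sorted′ : ∀ {s} → s ∈ C ++ cones m (low C) → Sorted s
    sorted′ s∈ with ∈-++⁻ C s∈
    ... | inj₁ s∈C = sorted s∈C
    ... | inj₂ s∈new with ∈-cones⁻ m (low C) s∈new
    ...   | σ , w , τ , c , τ⊆σ , refl =
      AllPairs.++⁺ (AllPairs-resp-⊆ τ⊆σ (sorted σ∈C)) ([] ∷ [])
        (All.map (λ x<m → <-≤-trans x<m (ConeOf⇒≤ c) ∷ []) (All-resp-⊆ τ⊆σ (bounded σ∈C)))
      where
      σ∈C : σ ∈ C
      σ∈C = All.lookup low⊆ (ConeOf⇒∈ c)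

    closed′ : ∀ {s t} → s ∈ C ++ cones m (low C) → t ⊆ s → T (nonempty t) → t ∈ C ++ cones m (low C)
    closed′ s∈ t⊆s t≢[] with ∈-++⁻ C s∈
    ... | inj₁ s∈C = ∈-++⁺ˡ (closed s∈C t⊆s t≢[])
    ... | inj₂ s∈new with ∈-cones⁻ m (low C) s∈new
    ...   | σ , w , τ , c , τ⊆σ , refl with ∷ʳ-⊆⁻ τ w t⊆s
    ...     | inj₁ t⊆τ = ∈-++⁺ˡ (closed (All.lookup low⊆ (ConeOf⇒∈ c)) (⊆-trans t⊆τ τ⊆σ) t≢[])
    ...     | inj₂ (t′ , t′⊆τ , refl) = ∈-++⁺ʳ C (∈-cones⁺ c (⊆-trans t′⊆τ τ⊆σ))

    old∉new : ∀ {s} → ¬ (s ∈ C × s ∈ cones m (low C))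
    old∉new (s∈C , s∈new) with ∈-cones⁻ m (low C) s∈new
    ... | _ , _ , τ , c , _ , refl = fresh-∉ τ (ConeOf⇒≤ c) s∈C

WellFormed-K : ∀ n → WellFormed (proj₁ (K n)) (simplices n)
simplices-suc : ∀ n → simplices (suc n) ≡ simplices n ++ cones (proj₁ (K n)) (low (simplices n))

WellFormed-K zero = record
  { bounded = λ { (here refl) → s≤s z≤n ∷ [] }
  ; sorted  = λ { (here refl) → [] ∷ [] }
  ; closed  = λ { (here refl) (refl ∷ []) _ → here refl ; (here refl) (_ ∷ʳ []) () }
  ; unique  = [] ∷ [] }
WellFormed-K (suc n) = subst (WellFormed _) (sym (simplices-suc n)) (WellFormed-step (WellFormed-K n))

simplices-suc n = cong proj₂ (step-≡ (WellFormed-K n))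

-- Counting along one step

sum-by-dimension : (f : Simplex → ℕ) (c₀ c₁ c₂ : ℕ) →
  f [] ≡ 0 → (∀ a → f [ a ] ≡ c₀) → (∀ a b → f (a ∷ b ∷ []) ≡ c₁) →
  (∀ a b c → f (a ∷ b ∷ c ∷ []) ≡ c₂) →
  (l : List Simplex) → All (T ∘ dimAtMost2) l →
  sum (map f l) ≡ c₀ * count (hasDim 0) l + c₁ * count (hasDim 1) l + c₂ * count (hasDim 2) l
sum-by-dimension f c₀ c₁ c₂ f₋ f₀ f₁ f₂ = go
  where
  go : (l : List Simplex) → All (T ∘ dimAtMost2) l →
       sum (map f l) ≡ c₀ * count (hasDim 0) l + c₁ * count (hasDim 1) l + c₂ * count (hasDim 2) l
  go [] [] = base c₀ c₁ c₂
    where base : ∀ c₀ c₁ c₂ → 0 ≡ c₀ * 0 + c₁ * 0 + c₂ * 0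
          base = solve-∀
  go ([] ∷ l) (_ ∷ ls) = cong₂ _+_ f₋ (go l ls)
  go ((a ∷ []) ∷ l) (_ ∷ ls) = trans (cong₂ _+_ (f₀ a) (go l ls)) (vertex c₀ c₁ c₂ _ _ _)
    where vertex : ∀ c₀ c₁ c₂ x y z → c₀ + (c₀ * x + c₁ * y + c₂ * z) ≡ c₀ * suc x + c₁ * y + c₂ * z
          vertex = solve-∀
  go ((a ∷ b ∷ []) ∷ l) (_ ∷ ls) = trans (cong₂ _+_ (f₁ a b) (go l ls)) (edge c₀ c₁ c₂ _ _ _)
    where edge : ∀ c₀ c₁ c₂ x y z → c₁ + (c₀ * x + c₁ * y + c₂ * z) ≡ c₀ * x + c₁ * suc y + c₂ * z
          edge = solve-∀
  go ((a ∷ b ∷ c ∷ []) ∷ l) (_ ∷ ls) = trans (cong₂ _+_ (f₂ a b c) (go l ls)) (triangle c₀ c₁ c₂ _ _ _)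
    where triangle : ∀ c₀ c₁ c₂ x y z → c₂ + (c₀ * x + c₁ * y + c₂ * z) ≡ c₀ * x + c₁ * y + c₂ * suc z
          triangle = solve-∀
  go ((_ ∷ _ ∷ _ ∷ _ ∷ _) ∷ _) (() ∷ _)

count-triangles-of-subsets : (q : Simplex → Bool) (σ : Simplex) → T (dimAtMost2 σ) →
  count (λ τ → hasDim 2 τ ∧ q τ) (subsets σ) ≡ count (λ τ → hasDim 2 τ ∧ q τ) [ σ ]
count-triangles-of-subsets q [] _ = refl
count-triangles-of-subsets q (a ∷ []) _ = refl
count-triangles-of-subsets q (a ∷ b ∷ []) _ = refl
count-triangles-of-subsets q (a ∷ b ∷ c ∷ []) _ with q (a ∷ b ∷ c ∷ [])
... | true  = refl
... | false = refl

-- Triangles τ ++ [ w ] over the edges τ of σ that lie in exactly j tetrahedra; each of them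
-- lies in count (hasDim 2) [ σ ] ∈ {0, 1} tetrahedra (tetCount-new below).
newTriangles : ℕ → Simplex → ℕ
newTriangles j σ = count (λ τ → hasDim 1 τ ∧ (count (hasDim 2) [ σ ] ≡ᵇ j)) (subsets σ)

module Growth (n : ℕ) where
  private
    C L : List Simplex
    C = simplices n
    L = low C
    m : ℕ
    m = proj₁ (K n)
    wf : WellFormed m C
    wf = WellFormed-K n
    L⊆C : All (_∈ C) L
    L⊆C = low⊆ wf
  open WellFormed wf

  low-dim : All (T ∘ dimAtMost2) L
  low-dim = All.tabulate (proj₂ ∘ ∈-filter⁻ (T? ∘ dimAtMost2) {xs = C})

  count-low : ∀ d → d ≤ 2 → count (hasDim d) L ≡ count (hasDim d) C
  count-low d d≤2 = count-filterᵇ (hasDim d) dimAtMost2 C (λ {σ} → hasDim⇒dimAtMost2 d≤2 σ)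

  count-suc : (p : Simplex → Bool) → count p (simplices (suc n)) ≡ count p C + count p (cones m L)
  count-suc p = trans (cong (count p) (simplices-suc n)) (count-++ p C (cones m L))

  N₂-suc : N₂ (suc n) ≡ N₂ n + (N₁ n + 3 * N₂ n)
  N₂-suc = begin
    N₂ (suc n)
      ≡⟨ count-suc (hasDim 2) ⟩
    N₂ n + count (hasDim 2) (cones m L)
      ≡⟨ cong (N₂ n +_) (count-cones (hasDim 2) (count (hasDim 1) ∘ subsets) m L per-cone) ⟩
    N₂ n + sum (map (count (hasDim 1) ∘ subsets) L)
      ≡⟨ cong (N₂ n +_) (sum-by-dimension _ 0 1 3 refl (λ _ → refl) (λ _ _ → refl) (λ _ _ _ → refl) L low-dim) ⟩
    N₂ n + (0 * count (hasDim 0) L + 1 * count (hasDim 1) L + 3 * count (hasDim 2) L)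
      ≡⟨ cong (N₂ n +_) (drop-vertices (count (hasDim 0) L) (count (hasDim 1) L) (count (hasDim 2) L)) ⟩
    N₂ n + (count (hasDim 1) L + 3 * count (hasDim 2) L)
      ≡⟨ cong₂ (λ e f → N₂ n + (e + 3 * f)) (count-low 1 (s≤s z≤n)) (count-low 2 ≤-refl) ⟩
    N₂ n + (N₁ n + 3 * N₂ n)
      ∎
    where
    open ≡-Reasoning
    per-cone : ∀ {σ w} → ConeOf m L σ w → count (hasDim 2) (cone σ w) ≡ count (hasDim 1) (subsets σ)
    per-cone {σ} {w} _ = trans (count-map (hasDim 2) (_++ [ w ]) (subsets σ))
                               (count-cong _ (hasDim 1) (subsets σ) (λ {τ} _ → hasDim-++[] 1 τ w))
    drop-vertices : ∀ x y z → 0 * x + 1 * y + 3 * z ≡ y + 3 * z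
    drop-vertices = solve-∀

  w∉old : ∀ {σ w} → ConeOf m L σ w → ∀ {s} → s ∈ C → w ∉ s
  w∉old c s∈C w∈s = <-irrefl refl (<-≤-trans (All.lookup (bounded s∈C) w∈s) (ConeOf⇒≤ c))

  new-tetrahedra-over-old : ∀ {t} → t ∈ C → T (hasDim 2 t) → count (tetOver t) (cones m L) ≡ 1
  new-tetrahedra-over-old {t} t∈C t-tri = begin
    count (tetOver t) (cones m L)
      ≡⟨ count-cones (tetOver t) (λ σ → count triOver [ σ ]) m L per-cone ⟩
    sum (map (λ σ → count triOver [ σ ]) L)
      ≡⟨ sum-count-[] triOver L ⟩
    count triOver L
      ≡⟨ count-filterᵇ triOver dimAtMost2 C (λ {σ} → tri⇒low {σ}) ⟩
    count triOver C
      ≡⟨ count-cong triOver (eqS t) C (λ σ∈C → triangle-face-≡ (sorted t∈C) (sorted σ∈C) t-tri) ⟩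
    count (eqS t) C
      ≡⟨ count-unique eqS eqS⇒≡ eqS-refl unique t∈C ⟩
    1
      ∎
    where
    open ≡-Reasoning
    triOver : Simplex → Bool
    triOver σ = hasDim 2 σ ∧ isFace t σ
    tri⇒low : ∀ {σ} → T (triOver σ) → T (dimAtMost2 σ)
    tri⇒low {σ} h = hasDim⇒dimAtMost2 ≤-refl σ (proj₁ (Equivalence.to T-∧ h))
    per-cone : ∀ {σ w} → ConeOf m L σ w → count (tetOver t) (cone σ w) ≡ count triOver [ σ ]
    per-cone {σ} {w} c = begin
      count (tetOver t) (cone σ w)
        ≡⟨ count-map (tetOver t) (_++ [ w ]) (subsets σ) ⟩
      count (λ τ → tetOver t (τ ++ [ w ])) (subsets σ)
        ≡⟨ count-cong _ triOver (subsets σ)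
                      (λ {τ} _ → cong₂ _∧_ (hasDim-++[] 2 τ w) (isFace-++[] t τ w (w∉old c t∈C))) ⟩
      count triOver (subsets σ)
        ≡⟨ count-triangles-of-subsets (isFace t) σ (All.lookup low-dim (ConeOf⇒∈ c)) ⟩
      count triOver [ σ ]
        ∎

  tetCount-old : ∀ {t} → t ∈ C → T (hasDim 2 t) → tetCount (suc n) t ≡ suc (tetCount n t)
  tetCount-old {t} t∈C t-tri =
    trans (count-suc (tetOver t)) (trans (cong (tetCount n t +_) (new-tetrahedra-over-old t∈C t-tri))
                                         (+-comm (tetCount n t) 1))

  new-tetrahedra-over-new : ∀ {σ w τ} → ConeOf m L σ w → τ ⊆ σ →
                            count (tetOver (τ ++ [ w ])) (cones m L) ≡ count (hasDim 2) [ σ ]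
  new-tetrahedra-over-new {σ} {w} {τ} c τ⊆σ = begin
    count (tetOver t) (cones m L)
      ≡⟨ count-cones-apex (tetOver t) c other-cone ⟩
    count (tetOver t) (cone σ w)
      ≡⟨ count-map (tetOver t) (_++ [ w ]) (subsets σ) ⟩
    count (λ τ′ → tetOver t (τ′ ++ [ w ])) (subsets σ)
      ≡⟨ count-cong _ (λ τ′ → hasDim 2 τ′ ∧ isFace t (τ′ ++ [ w ])) (subsets σ)
                    (λ {τ′} _ → cong (_∧ isFace t (τ′ ++ [ w ])) (hasDim-++[] 2 τ′ w)) ⟩
    count (λ τ′ → hasDim 2 τ′ ∧ isFace t (τ′ ++ [ w ])) (subsets σ)
      ≡⟨ count-triangles-of-subsets (λ τ′ → isFace t (τ′ ++ [ w ])) σ (All.lookup low-dim (ConeOf⇒∈ c)) ⟩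
    count (λ τ′ → hasDim 2 τ′ ∧ isFace t (τ′ ++ [ w ])) [ σ ]
      ≡⟨ count-cong (λ τ′ → hasDim 2 τ′ ∧ isFace t (τ′ ++ [ w ])) (hasDim 2) [ σ ]
                    (λ { (here refl) → t-face-of-σw }) ⟩
    count (hasDim 2) [ σ ]
      ∎
    where
    open ≡-Reasoning
    t : Simplex
    t = τ ++ [ w ]
    w∈t : w ∈ t
    w∈t = ∈-++⁺ʳ τ (here refl)
    other-cone : ∀ {σ′ w′} → ConeOf m L σ′ w′ → w′ ≢ w → count (tetOver t) (cone σ′ w′) ≡ 0
    other-cone {σ′} {w′} c′ w′≢w = count-none (tetOver t) (cone σ′ w′) λ u∈ → tetOver-∉ w∈t (w∉ u∈)
      where
      w∉ : ∀ {u} → u ∈ cone σ′ w′ → w ∉ u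
      w∉ u∈ w∈u with ∈-map⁻ (_++ [ w′ ]) u∈
      ... | τ′ , τ′∈ , refl with ∈-++⁻ τ′ w∈u
      ...   | inj₁ w∈τ′ = w∉old c (All.lookup L⊆C (ConeOf⇒∈ c′)) (Any-resp-⊆ (∈-subsets⁻ τ′∈) w∈τ′)
      ...   | inj₂ (here refl) = w′≢w refl
    t-face-of-σw : (hasDim 2 σ ∧ isFace t (σ ++ [ w ])) ≡ hasDim 2 σ
    t-face-of-σw rewrite Equivalence.to T-≡ (Equivalence.from (isFace⇔All∈ t (σ ++ [ w ]))
                                                               (All.tabulate (Any-resp-⊆ (∷ʳ-⊆⁺ w τ⊆σ))))
      = ∧-identityʳ (hasDim 2 σ)

  tetCount-new : ∀ {σ w τ} → ConeOf m L σ w → τ ⊆ σ → tetCount (suc n) (τ ++ [ w ]) ≡ count (hasDim 2) [ σ ]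
  tetCount-new {σ} {w} {τ} c τ⊆σ =
    trans (count-suc (tetOver t))
          (cong₂ _+_ (count-none (tetOver t) C (λ s∈C → tetOver-∉ (∈-++⁺ʳ τ (here refl)) (w∉old c s∈C)))
                     (new-tetrahedra-over-new c τ⊆σ))
    where
    t : Simplex
    t = τ ++ [ w ]

  D2-suc : ∀ j → D2 j (suc n) ≡ count (λ t → hasDim 2 t ∧ (suc (tetCount n t) ≡ᵇ j)) C
                               + sum (map (newTriangles j) L)
  D2-suc j = trans (count-suc _) (cong₂ _+_ (count-cong _ _ C old) (count-cones _ (newTriangles j) m L new))
    where
    old : ∀ {t} → t ∈ C →
          (hasDim 2 t ∧ (tetCount (suc n) t ≡ᵇ j)) ≡ (hasDim 2 t ∧ (suc (tetCount n t) ≡ᵇ j))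
    old {t} t∈C with hasDim 2 t in t-tri
    ... | false = refl
    ... | true  = cong (_≡ᵇ j) (tetCount-old t∈C (subst T (sym t-tri) _))
    new : ∀ {σ w} → ConeOf m L σ w →
          count (λ t → hasDim 2 t ∧ (tetCount (suc n) t ≡ᵇ j)) (cone σ w) ≡ newTriangles j σ
    new {σ} {w} c = trans (count-map _ (_++ [ w ]) (subsets σ)) (count-cong _ _ (subsets σ) λ {τ} τ∈ →
      cong₂ _∧_ (hasDim-++[] 1 τ w) (cong (_≡ᵇ j) (tetCount-new c (∈-subsets⁻ τ∈))))

  D2-zero : D2 0 (suc n) ≡ N₁ n
  D2-zero = begin
    D2 0 (suc n)
      ≡⟨ D2-suc 0 ⟩
    count (λ t → hasDim 2 t ∧ false) C + sum (map (newTriangles 0) L)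
      ≡⟨ cong₂ _+_ (count-none _ C (λ {t} _ → ∧-zeroʳ (hasDim 2 t)))
                   (sum-by-dimension _ 0 1 0 refl (λ _ → refl) (λ _ _ → refl) (λ _ _ _ → refl) L low-dim) ⟩
    0 * count (hasDim 0) L + 1 * count (hasDim 1) L + 0 * count (hasDim 2) L
      ≡⟨ edges-only (count (hasDim 0) L) (count (hasDim 1) L) (count (hasDim 2) L) ⟩
    count (hasDim 1) L
      ≡⟨ count-low 1 (s≤s z≤n) ⟩
    N₁ n
      ∎
    where
    open ≡-Reasoning
    edges-only : ∀ x y z → 0 * x + 1 * y + 0 * z ≡ y
    edges-only = solve-∀

  D2-one : D2 1 (suc n) ≡ D2 0 n + 3 * N₂ n
  D2-one = begin
    D2 1 (suc n)
      ≡⟨ D2-suc 1 ⟩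
    D2 0 n + sum (map (newTriangles 1) L)
      ≡⟨ cong (D2 0 n +_) (sum-by-dimension _ 0 0 3 refl (λ _ → refl) (λ _ _ → refl) (λ _ _ _ → refl) L low-dim) ⟩
    D2 0 n + (0 * count (hasDim 0) L + 0 * count (hasDim 1) L + 3 * count (hasDim 2) L)
      ≡⟨ cong (D2 0 n +_) (triangles-only (count (hasDim 0) L) (count (hasDim 1) L) (count (hasDim 2) L)) ⟩
    D2 0 n + 3 * count (hasDim 2) L
      ≡⟨ cong (λ k → D2 0 n + 3 * k) (count-low 2 ≤-refl) ⟩
    D2 0 n + 3 * N₂ n
      ∎
    where
    open ≡-Reasoning
    triangles-only : ∀ x y z → 0 * x + 0 * y + 3 * z ≡ 3 * z
    triangles-only = solve-∀

  D2-suc-suc : ∀ j → D2 (suc (suc j)) (suc n) ≡ D2 (suc j) n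
  D2-suc-suc j = begin
    D2 (suc (suc j)) (suc n)
      ≡⟨ D2-suc (suc (suc j)) ⟩
    D2 (suc j) n + sum (map (newTriangles (suc (suc j))) L)
      ≡⟨ cong (D2 (suc j) n +_) (sum-by-dimension _ 0 0 0 refl (λ _ → refl) (λ _ _ → refl) (λ _ _ _ → refl) L low-dim) ⟩
    D2 (suc j) n + (0 * count (hasDim 0) L + 0 * count (hasDim 1) L + 0 * count (hasDim 2) L)
      ≡⟨ cong (D2 (suc j) n +_) (nothing (count (hasDim 0) L) (count (hasDim 1) L) (count (hasDim 2) L)) ⟩
    D2 (suc j) n + 0
      ≡⟨ +-identityʳ _ ⟩
    D2 (suc j) n
      ∎
    where
    open ≡-Reasoning
    nothing : ∀ x y z → 0 * x + 0 * y + 0 * z ≡ 0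
    nothing = solve-∀

-- The recurrences for D⁽²⁾ in closed form

D2-shift : ∀ k p → D2 (suc k) (k + p) ≡ D2 1 p
D2-shift zero    p = refl
D2-shift (suc k) p = trans (Growth.D2-suc-suc (k + p) k) (D2-shift k p)

D2-one-recurrence : ∀ q → D2 1 (suc (suc q)) + 4 * N₂ q ≡ 4 * N₂ (suc q)
D2-one-recurrence q = begin
  D2 1 (suc (suc q)) + 4 * N₂ q
    ≡⟨ cong (_+ 4 * N₂ q) (trans (Growth.D2-one (suc q)) (cong (_+ 3 * N₂ (suc q)) (Growth.D2-zero q))) ⟩
  N₁ q + 3 * N₂ (suc q) + 4 * N₂ q
    ≡⟨ cong (λ x → N₁ q + 3 * x + 4 * N₂ q) (Growth.N₂-suc q) ⟩
  N₁ q + 3 * (N₂ q + (N₁ q + 3 * N₂ q)) + 4 * N₂ q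
    ≡⟨ regroup (N₁ q) (N₂ q) ⟩
  4 * (N₂ q + (N₁ q + 3 * N₂ q))
    ≡⟨ cong (4 *_) (Growth.N₂-suc q) ⟨
  4 * N₂ (suc q)
    ∎
  where
  open ≡-Reasoning
  regroup : ∀ e t → e + 3 * (t + (e + 3 * t)) + 4 * t ≡ 4 * (t + (e + 3 * t))
  regroup = solve-∀

D2-recurrence : ∀ k p → D2 (suc k) (k + suc (suc p)) + 4 * N₂ (k + suc (suc p) ∸ suc k ∸ 1)
                          ≡ 4 * N₂ (k + suc (suc p) ∸ suc k)
D2-recurrence k p = begin
  D2 (suc k) (k + suc (suc p)) + 4 * N₂ (k + suc (suc p) ∸ suc k ∸ 1)
    ≡⟨ cong₂ (λ d q → d + 4 * N₂ (q ∸ 1)) (D2-shift k (suc (suc p))) (+-suc-∸ (suc p)) ⟩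
  D2 1 (suc (suc p)) + 4 * N₂ p
    ≡⟨ D2-one-recurrence p ⟩
  4 * N₂ (suc p)
    ≡⟨ cong (λ q → 4 * N₂ q) (+-suc-∸ (suc p)) ⟨
  4 * N₂ (k + suc (suc p) ∸ suc k)
    ∎
  where
  open ≡-Reasoning
  +-suc-∸ : ∀ q → k + suc q ∸ suc k ≡ q
  +-suc-∸ q = trans (cong (_∸ suc k) (+-suc k q)) (m+n∸m≡n k q)

mainTheorem13 : ((n : ℕ) → 2 ≤ n → D2 0 n ≡ N₁ (n ∸ 1))
    × ((n k : ℕ) → 3 ≤ n → 1 ≤ k → k ≤ n ∸ 2 →
        D2 k n + 4 * N₂ (n ∸ k ∸ 1) ≡ 4 * N₂ (n ∸ k))
mainTheorem13 = (λ { (suc n) _ → Growth.D2-zero n }) , higher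
  where
  higher : (n k : ℕ) → 3 ≤ n → 1 ≤ k → k ≤ n ∸ 2 → D2 k n + 4 * N₂ (n ∸ k ∸ 1) ≡ 4 * N₂ (n ∸ k)
  higher (suc (suc n)) (suc k) _ _ k<n with m≤n⇒∃[o]m+o≡n k<n
  ... | r , refl = subst (λ n → D2 (suc k) n + 4 * N₂ (n ∸ suc k ∸ 1) ≡ 4 * N₂ (n ∸ suc k))
                         (reindex k r) (D2-recurrence k (suc r))
    where
    reindex : ∀ k r → k + suc (suc (suc r)) ≡ suc (suc (suc (k + r)))
    reindex = solve-∀
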